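{- Let $R$ be an infinite, reduced and indecomposable ring, and let $f\in R[x]$. If $f(c)=0$ for all $c\in R$, then $f=0$.
   Context: All rings are nonzero, commutative and unital. Reduced: no nonzero nilpotent elements; indecomposable: the only idempotents are $0$ and $1$. -}

module Defs where

open import Level using (_⊔_)
open import Algebra.Bundles using (CommutativeRing)
open import Data.Nat using (ℕ; zero; suc)
open import Data.Fin using (Fin)
open import Data.List using (List; []; _∷_)
open import Data.List.Relation.Unary.All using (All)
open import Data.Product using (Σ; ∃; _,_)
open import Data.Sum using (_⊎_)
open import Relation.Nullary using (¬_)

module _ {c ℓ} (R : CommutativeRing c ℓ) where
  open CommutativeRing R

  pow : Carrier → ℕ → Carrier
  pow x zero    = 1#
  pow x (suc n) = x * pow x n

  Nontrivial : Set ℓ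
  Nontrivial = ¬ (1# ≈ 0#)

  Reduced : Set (c ⊔ ℓ)
  Reduced = ∀ (x : Carrier) (n : ℕ) → pow x n ≈ 0# → x ≈ 0#

  Indecomposable : Set (c ⊔ ℓ)
  Indecomposable = ∀ (e : Carrier) → e * e ≈ e → (e ≈ 0#) ⊎ (e ≈ 1#)

  FiniteRing : Set (c ⊔ ℓ)
  FiniteRing = Σ ℕ λ n → Σ (Fin n → Carrier) λ g → ∀ (x : Carrier) → ∃ λ i → x ≈ g i

  Infinite : Set (c ⊔ ℓ)
  Infinite = ¬ FiniteRing

  -- polynomials in R[x]: coefficient lists a₀ ∷ a₁ ∷ … (ascending degree)
  Poly : Set c
  Poly = List Carrier

  eval : Poly → Carrier → Carrier
  eval []      _ = 0#
  eval (a ∷ p) t = a + t * eval p t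

  IsZeroPoly : Poly → Set (c ⊔ ℓ)
  IsZeroPoly p = All (λ a → a ≈ 0#) p

-- It suffices to show that the leading coefficient b of such an f of degree
-- n vanishes; the theorem then follows by peeling off coefficients.
--  1. Vandermonde weighting.  Replacing f(x) by t^k f(x) - f(t x) multiplies
--     the coefficient of x^j by (t^k - t^j) and preserves vanishing.  Doing
--     this for k = 0, …, n-1 and evaluating at 1 gives
--     b · ∏_{k<n} (t^k - t^n) = 0 for all t ∈ R.
--  2. Shape.  ∏_{k<n} (t^k - t^n) = t^K (1 + t r).  If t annihilates such an
--     element, reducedness gives t (1 + t r) = 0, so -t r is idempotent and
--     indecomposability makes t zero or invertible.  Taking t = b: b is 0 or
--     invertible.
--  3. If b were invertible, ∏_{k<n} (t^k - t^n) = 0 for all t, so by step 2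
--     R is a field in which every t satisfies t^(n!+1) = t.  A monic
--     polynomial has only finitely many roots in a domain, and an infinite
--     field with decidable equality has arbitrarily many distinct elements:
--     contradiction.
module Submission where

open import Defs
open import Algebra.Bundles using (CommutativeRing)
open import Level using (_⊔_)
open import Data.Product as Prod using (Σ; ∃; _,_)
open import Data.Empty using (⊥-elim)
open import Function using (id)
open import Data.Sum as Sum using (_⊎_; inj₁; inj₂)
open import Data.List using (List; []; _∷_; _++_; length; lookup)
open import Data.List.Relation.Unary.All as All using (All; []; _∷_)
open import Data.List.Relation.Unary.All.Properties using (¬Any⇒All¬; ∷ʳ⁺)
open import Data.List.Relation.Unary.AllPairs using (AllPairs; []; _∷_)
open import Data.List.Relation.Unary.Any as Any using (any?)
open import Data.List.Relation.Unary.Any.Properties using (lookup-index)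
open import Data.List.Reverse using (Reverse; reverseView; []; _∶_∶ʳ_)
open import Data.Nat as ℕ using (ℕ; zero; suc)
import Data.Nat.Properties as ℕₚ
open import Data.Nat.Divisibility using (divides; ∣-trans; m∣m*n; m≤n⇒m!∣n!)
open import Data.Integer as ℤ using (ℤ; +_; -[1+_])
import Data.Integer.Properties as ℤₚ
import Data.Sign as Sign
open import Data.Maybe using (Maybe; just; nothing)
open import Relation.Nullary using (¬_; yes; no)
open import Relation.Binary.Definitions using (Decidable)
open import Relation.Binary.PropositionalEquality as ≡ using (_≡_)
import Algebra.Solver.Ring.AlmostCommutativeRing as ACR
import Algebra.Solver.Ring

module IntegerCoefficientSolver {c ℓ} (R : CommutativeRing c ℓ) where
  open CommutativeRing R
  open import Algebra.Properties.Ring ring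
    using (-0#≈0#; -‿+-comm; -‿involutive; -‿distribˡ-*; -‿distribʳ-*)
  open import Algebra.Properties.CommutativeSemigroup +-commutativeSemigroup using (interchange)
  open import Algebra.Properties.Semiring.Mult.TCOptimised semiring using (_×_; ×-homo-+; ×1-homo-*)
  open import Relation.Binary.Reasoning.Setoid setoid

  fromℤ : ℤ → Carrier
  fromℤ (+ n)      = n × 1#
  fromℤ -[1+ n ] = - (suc n × 1#)

  sub-cancelˡ : ∀ x a b → (x + a) - (x + b) ≈ a - b
  sub-cancelˡ x a b = begin
    (x + a) + - (x + b)   ≈⟨ +-congˡ (-‿+-comm x b) ⟨
    (x + a) + (- x + - b) ≈⟨ interchange x a (- x) (- b) ⟩
    (x - x) + (a - b)     ≈⟨ +-congʳ (-‿inverseʳ x) ⟩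
    0# + (a - b)          ≈⟨ +-identityˡ _ ⟩
    a - b                 ∎

  ⊖-homo : ∀ m n → fromℤ (m ℤ.⊖ n) ≈ m × 1# - n × 1#
  ⊖-homo zero    zero    = sym (-‿inverseʳ 0#)
  ⊖-homo (suc m) zero    = sym (trans (+-congˡ -0#≈0#) (+-identityʳ _))
  ⊖-homo zero    (suc n) = sym (+-identityˡ _)
  ⊖-homo (suc m) (suc n) rewrite ℤₚ.[1+m]⊖[1+n]≡m⊖n m n =
    trans (⊖-homo m n) (sym (trans (+-cong (×-homo-+ 1# 1 m) (-‿cong (×-homo-+ 1# 1 n)))
                                   (sub-cancelˡ 1# (m × 1#) (n × 1#))))

  +-homo : ∀ i j → fromℤ (i ℤ.+ j) ≈ fromℤ i + fromℤ j
  +-homo -[1+ m ] -[1+ n ] = begin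
    - (suc (suc (m ℕ.+ n)) × 1#)         ≡⟨ ≡.cong (λ k → - (suc k × 1#)) (ℕₚ.+-suc m n) ⟨
    - ((suc m ℕ.+ suc n) × 1#)           ≈⟨ -‿cong (×-homo-+ 1# (suc m) (suc n)) ⟩
    - (suc m × 1# + suc n × 1#)          ≈⟨ -‿+-comm _ _ ⟨
    - (suc m × 1#) + - (suc n × 1#)      ∎
  +-homo -[1+ m ] (+ n)    = trans (⊖-homo n (suc m)) (+-comm _ _)
  +-homo (+ m)    -[1+ n ] = ⊖-homo m (suc n)
  +-homo (+ m)    (+ n)    = ×-homo-+ 1# m n

  -- images of sign-magnitude integers s ◃ k, which ℤ multiplication produces
  +◃-homo : ∀ k → fromℤ (Sign.+ ℤ.◃ k) ≈ k × 1#
  +◃-homo zero    = refl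
  +◃-homo (suc k) = refl

  -◃-homo : ∀ k → fromℤ (Sign.- ℤ.◃ k) ≈ - (k × 1#)
  -◃-homo zero    = sym -0#≈0#
  -◃-homo (suc k) = refl

  *-homo : ∀ i j → fromℤ (i ℤ.* j) ≈ fromℤ i * fromℤ j
  *-homo -[1+ m ] -[1+ n ] = begin
    fromℤ (Sign.+ ℤ.◃ (suc m ℕ.* suc n))         ≈⟨ +◃-homo (suc m ℕ.* suc n) ⟩
    (suc m ℕ.* suc n) × 1#                  ≈⟨ ×1-homo-* (suc m) (suc n) ⟩
    suc m × 1# * suc n × 1#                 ≈⟨ -‿involutive _ ⟨
    - - (suc m × 1# * suc n × 1#)           ≈⟨ -‿cong (-‿distribʳ-* _ _) ⟩
    - (suc m × 1# * - (suc n × 1#))         ≈⟨ -‿distribˡ-* _ _ ⟩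
    - (suc m × 1#) * - (suc n × 1#)         ∎
  *-homo -[1+ m ] (+ n)    =
    trans (-◃-homo (suc m ℕ.* n)) (trans (-‿cong (×1-homo-* (suc m) n)) (-‿distribˡ-* _ _))
  *-homo (+ m)    -[1+ n ] =
    trans (-◃-homo (m ℕ.* suc n)) (trans (-‿cong (×1-homo-* m (suc n))) (-‿distribʳ-* _ _))
  *-homo (+ m)    (+ n)    = trans (+◃-homo (m ℕ.* n)) (×1-homo-* m n)

  neg-homo : ∀ i → fromℤ (ℤ.- i) ≈ - fromℤ i
  neg-homo -[1+ n ]  = sym (-‿involutive _)
  neg-homo (+ zero)  = sym -0#≈0#
  neg-homo (+ suc n) = refl

  homomorphism : ℤ.+-*-rawRing ACR.-Raw-AlmostCommutative⟶ ACR.fromCommutativeRing R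
  homomorphism = record
    { ⟦_⟧ = fromℤ ; +-homo = +-homo ; *-homo = *-homo ; -‿homo = neg-homo
    ; 0-homo = refl ; 1-homo = refl }

  coefficient-equality : ∀ i j → Maybe (fromℤ i ≈ fromℤ j)
  coefficient-equality i j with i ℤ.≟ j
  ... | yes ≡.refl = just refl
  ... | no _       = nothing

  open Algebra.Solver.Ring ℤ.+-*-rawRing (ACR.fromCommutativeRing R) homomorphism coefficient-equality public
    using (solve; _:=_; _:+_; _:*_; _:-_; :-_; con)

module _ {c ℓ} (R : CommutativeRing c ℓ) where
  open CommutativeRing R
  open import Algebra.Properties.Ring ring using (x∙y⁻¹≈ε⇒x≈y; x≈y⇒x∙y⁻¹≈ε)
  open import Algebra.Properties.CommutativeSemiring.Exp commutativeSemiring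
    using (_^_; ^-homo-*; ^-assocʳ; ^-distrib-*; ^-congˡ; ^-congʳ)
  open import Algebra.Properties.CommutativeSemigroup *-commutativeSemigroup using (xy∙z≈y∙xz)
  open import Relation.Binary.Reasoning.Setoid setoid
  open import Data.Product using (_×_)
  open IntegerCoefficientSolver R

  pow≈^ : ∀ x n → pow R x n ≈ x ^ n
  pow≈^ x zero    = refl
  pow≈^ x (suc n) = *-congˡ (pow≈^ x n)

  1^n≈1 : ∀ n → 1# ^ n ≈ 1#
  1^n≈1 zero    = refl
  1^n≈1 (suc n) = trans (*-identityˡ _) (1^n≈1 n)

  Invertible : Carrier → Set (c ⊔ ℓ)
  Invertible u = Σ Carrier λ v → u * v ≈ 1#

  invertible-cancelˡ : ∀ {u x y} → Invertible u → u * x ≈ u * y → x ≈ y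
  invertible-cancelˡ {u} {x} {y} (v , uv≈1) ux≈uy = begin
    x             ≈⟨ *-identityˡ x ⟨
    1# * x        ≈⟨ *-congʳ uv≈1 ⟨
    (u * v) * x   ≈⟨ xy∙z≈y∙xz u v x ⟩
    v * (u * x)   ≈⟨ *-congˡ ux≈uy ⟩
    v * (u * y)   ≈⟨ xy∙z≈y∙xz u v y ⟨
    (u * v) * y   ≈⟨ *-congʳ uv≈1 ⟩
    1# * y        ≈⟨ *-identityˡ y ⟩
    y             ∎

  invertible-^ : ∀ {u} n → Invertible u → Invertible (u ^ n)
  invertible-^ {u} n (v , uv≈1) = v ^ n , (begin
    u ^ n * v ^ n   ≈⟨ ^-distrib-* u v n ⟨
    (u * v) ^ n     ≈⟨ ^-congˡ n uv≈1 ⟩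
    1# ^ n          ≈⟨ 1^n≈1 n ⟩
    1#              ∎)

  -- Coefficient-wise weighting: the coefficient of x^j in p is
  -- multiplied by w (i + j).
  weighted : (ℕ → Carrier) → ℕ → Poly R → Poly R
  weighted w i []      = []
  weighted w i (a ∷ p) = a * w i ∷ weighted w (suc i) p

  weighted-by-1 : ∀ i p x → eval R (weighted (λ _ → 1#) i p) x ≈ eval R p x
  weighted-by-1 i []      x = refl
  weighted-by-1 i (a ∷ p) x = +-cong (*-identityʳ a) (*-congˡ (weighted-by-1 (suc i) p x))

  -- Multiplying the weights by (t^k - t^j) is the operation
  -- q(x) ↦ t^k q(x) - q(t x), up to the factor t^i caused by the offset i:
  -- it sends a_j x^j to (t^k - t^j) a_j x^j.
  weighted-difference : ∀ w t k i p x →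
    eval R (weighted (λ j → w j * (t ^ k - t ^ j)) i p) x
      ≈ t ^ k * eval R (weighted w i p) x - t ^ i * eval R (weighted w i p) (t * x)
  weighted-difference w t k i []      x =
    solve 2 (λ a b → con (+ 0) := a :* con (+ 0) :- b :* con (+ 0)) refl (t ^ k) (t ^ i)
  weighted-difference w t k i (a ∷ p) x = begin
    a * (w i * (t ^ k - t ^ i)) + x * eval R (weighted _ (suc i) p) x
      ≈⟨ +-congˡ (*-congˡ (weighted-difference w t k (suc i) p x)) ⟩
    a * (w i * (t ^ k - t ^ i)) + x * (t ^ k * A - t ^ suc i * B)
      ≈⟨ solve 8 (λ a wi tk ti x t A B →
           a :* (wi :* (tk :- ti)) :+ x :* (tk :* A :- (t :* ti) :* B)
             := tk :* (a :* wi :+ x :* A) :- ti :* (a :* wi :+ (t :* x) :* B))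
           refl a (w i) (t ^ k) (t ^ i) x t A B ⟩
    t ^ k * (a * w i + x * A) - t ^ i * (a * w i + (t * x) * B)
      ∎
    where
    A = eval R (weighted w (suc i) p) x
    B = eval R (weighted w (suc i) p) (t * x)

  vandermonde : Carrier → ℕ → ℕ → Carrier
  vandermonde t zero    j = 1#
  vandermonde t (suc m) j = vandermonde t m j * (t ^ m - t ^ j)

  weighted-vanishes : ∀ p → (∀ x → eval R p x ≈ 0#) →
    ∀ t m x → eval R (weighted (vandermonde t m) 0 p) x ≈ 0#
  weighted-vanishes p p-vanishes t zero    x = trans (weighted-by-1 0 p x) (p-vanishes x)
  weighted-vanishes p p-vanishes t (suc m) x = begin
    eval R (weighted (vandermonde t (suc m)) 0 p) x
      ≈⟨ weighted-difference (vandermonde t m) t m 0 p x ⟩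
    t ^ m * eval R (weighted (vandermonde t m) 0 p) x - 1# * eval R (weighted (vandermonde t m) 0 p) (t * x)
      ≈⟨ +-cong (*-congˡ (weighted-vanishes p p-vanishes t m x)) (-‿cong (*-congˡ (weighted-vanishes p p-vanishes t m (t * x)))) ⟩
    t ^ m * 0# - 1# * 0#
      ≈⟨ solve 1 (λ a → a :* con (+ 0) :- con (+ 1) :* con (+ 0) := con (+ 0)) refl (t ^ m) ⟩
    0# ∎

  -- the factor k = j kills vandermonde t m j when j < m
  vandermonde-below : ∀ t {m j} → j ℕ.< m → vandermonde t m j ≈ 0#
  vandermonde-below t {suc m} {j} j<1+m with ℕₚ.m≤n⇒m<n∨m≡n (ℕₚ.≤-pred j<1+m)
  ... | inj₁ j<m      = trans (*-congʳ (vandermonde-below t j<m)) (zeroˡ _)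
  ... | inj₂ ≡.refl   = trans (*-congˡ (-‿inverseʳ _)) (zeroʳ _)

  weighted-at-1 : ∀ w i p b → (∀ j → j ℕ.< i ℕ.+ length p → w j ≈ 0#) →
    eval R (weighted w i (p ++ b ∷ [])) 1# ≈ b * w (i ℕ.+ length p)
  weighted-at-1 w i []      b w≈0 = begin
    b * w i + 1# * 0#     ≈⟨ +-congˡ (zeroʳ 1#) ⟩
    b * w i + 0#          ≈⟨ +-identityʳ _ ⟩
    b * w i               ≡⟨ ≡.cong (λ k → b * w k) (ℕₚ.+-identityʳ i) ⟨
    b * w (i ℕ.+ 0)       ∎
  weighted-at-1 w i (a ∷ p) b w≈0 = begin
    a * w i + 1# * eval R (weighted w (suc i) (p ++ b ∷ [])) 1#
      ≈⟨ +-cong (*-congˡ (w≈0 i i<i+1+n)) (*-identityˡ _) ⟩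
    a * 0# + eval R (weighted w (suc i) (p ++ b ∷ [])) 1#
      ≈⟨ +-cong (zeroʳ a) (weighted-at-1 w (suc i) p b w≈0′) ⟩
    0# + b * w (suc i ℕ.+ length p)
      ≈⟨ +-identityˡ _ ⟩
    b * w (suc i ℕ.+ length p)
      ≡⟨ ≡.cong (λ k → b * w k) (ℕₚ.+-suc i (length p)) ⟨
    b * w (i ℕ.+ suc (length p)) ∎
    where
    i<i+1+n : i ℕ.< i ℕ.+ suc (length p)
    i<i+1+n = ℕₚ.m<m+n i ℕ.z<s
    w≈0′ : ∀ j → j ℕ.< suc i ℕ.+ length p → w j ≈ 0#
    w≈0′ j lt = w≈0 j (≡.subst (j ℕ.<_) (≡.sym (ℕₚ.+-suc i (length p))) lt)

  leading-annihilates-vandermonde : ∀ p b → (∀ x → eval R (p ++ b ∷ []) x ≈ 0#) →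
    ∀ t → b * vandermonde t (length p) (length p) ≈ 0#
  leading-annihilates-vandermonde p b f-vanishes t = begin
    b * vandermonde t n n                      ≈⟨ weighted-at-1 (vandermonde t n) 0 p b (λ j → vandermonde-below t) ⟨
    eval R (weighted (vandermonde t n) 0 (p ++ b ∷ [])) 1#  ≈⟨ weighted-vanishes (p ++ b ∷ []) f-vanishes t n 1# ⟩
    0#                                         ∎
    where n = length p

  PowerTimesOnePlus : Carrier → Carrier → Set (c ⊔ ℓ)
  PowerTimesOnePlus t z = Σ ℕ λ K → Σ Carrier λ r → z ≈ t ^ K * (1# + t * r)

  power-times-one-plus-1 : ∀ t → PowerTimesOnePlus t 1#
  power-times-one-plus-1 t = 0 , 0# , solve 1 (λ t → con (+ 1) := con (+ 1) :* (con (+ 1) :+ t :* con (+ 0))) refl t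

  power-times-one-plus-* : ∀ {t y z} → PowerTimesOnePlus t y → PowerTimesOnePlus t z → PowerTimesOnePlus t (y * z)
  power-times-one-plus-* {t} {y} {z} (K , r , y≈) (L , s , z≈) = K ℕ.+ L , r + s + t * r * s , (begin
    y * z                                                ≈⟨ *-cong y≈ z≈ ⟩
    t ^ K * (1# + t * r) * (t ^ L * (1# + t * s))        ≈⟨ solve 5 (λ a b t r s →
                                                              a :* (con (+ 1) :+ t :* r) :* (b :* (con (+ 1) :+ t :* s))
                                                                := a :* b :* (con (+ 1) :+ t :* (r :+ s :+ t :* r :* s)))
                                                            refl (t ^ K) (t ^ L) t r s ⟩
    t ^ K * t ^ L * (1# + t * (r + s + t * r * s))       ≈⟨ *-congʳ (^-homo-* t K L) ⟨
    t ^ (K ℕ.+ L) * (1# + t * (r + s + t * r * s))       ∎)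

  power-times-one-plus-difference : ∀ t k d → PowerTimesOnePlus t (t ^ k - t ^ suc (k ℕ.+ d))
  power-times-one-plus-difference t k d = k , - t ^ d , (begin
    t ^ k - t * t ^ (k ℕ.+ d)          ≈⟨ +-congˡ (-‿cong (*-congˡ (^-homo-* t k d))) ⟩
    t ^ k - t * (t ^ k * t ^ d)        ≈⟨ solve 3 (λ t a b → a :- t :* (a :* b) := a :* (con (+ 1) :+ t :* (:- b)))
                                            refl t (t ^ k) (t ^ d) ⟩
    t ^ k * (1# + t * - t ^ d)         ∎)

  vandermonde-shape : ∀ t m {n} → m ℕ.≤ n → PowerTimesOnePlus t (vandermonde t m n)
  vandermonde-shape t zero    m≤n = power-times-one-plus-1 t
  vandermonde-shape t (suc m) m<n with ℕₚ.m≤n⇒∃[o]m+o≡n m<n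
  ... | d , ≡.refl = power-times-one-plus-* (vandermonde-shape t m (ℕₚ.<⇒≤ m<n)) (power-times-one-plus-difference t m d)

  -- In a reduced ring, t · t^K · w = 0 forces t · w = 0, since
  -- (t w)^(K+1) = (t t^K w) · w^K.
  reduced-drop-power : Reduced R → ∀ t K w → t * (t ^ K * w) ≈ 0# → t * w ≈ 0#
  reduced-drop-power reduced t K w ≈0 = reduced (t * w) (suc K) (begin
    pow R (t * w) (suc K)            ≈⟨ pow≈^ (t * w) (suc K) ⟩
    (t * w) ^ suc K                  ≈⟨ ^-distrib-* t w (suc K) ⟩
    (t * t ^ K) * (w * w ^ K)        ≈⟨ solve 4 (λ t a w b → (t :* a) :* (w :* b) := (t :* (a :* w)) :* b) refl t (t ^ K) w (w ^ K) ⟩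
    (t * (t ^ K * w)) * w ^ K        ≈⟨ *-congʳ ≈0 ⟩
    0# * w ^ K                       ≈⟨ zeroˡ _ ⟩
    0#                               ∎)

  -- If t (1 + t r) = 0 then e = -t r is idempotent with t e = t; so in an
  -- indecomposable ring either e = 0 (and t = 0) or e = 1 (and t is invertible).
  indecomposable-zero-or-invertible : Indecomposable R → ∀ t r → t * (1# + t * r) ≈ 0# → (t ≈ 0#) ⊎ Invertible t
  indecomposable-zero-or-invertible indecomposable t r ≈0 =
    Sum.map t≈0 (λ e≈1 → - r , e≈1) (indecomposable e e*e≈e)
    where
    e = t * - r
    t*e≈t : t * e ≈ t
    t*e≈t = begin
      t * (t * - r)            ≈⟨ solve 2 (λ t r → t :* (t :* :- r) := t :- t :* (con (+ 1) :+ t :* r)) refl t r ⟩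
      t - t * (1# + t * r)     ≈⟨ +-congˡ (-‿cong ≈0) ⟩
      t - 0#                   ≈⟨ solve 1 (λ t → t :- con (+ 0) := t) refl t ⟩
      t                        ∎
    e*e≈e : e * e ≈ e
    e*e≈e = trans (solve 2 (λ t r → (t :* :- r) :* (t :* :- r) := (t :* (t :* :- r)) :* :- r) refl t r) (*-congʳ t*e≈t)
    t≈0 : e ≈ 0# → t ≈ 0#
    t≈0 e≈0 = trans (sym t*e≈t) (trans (*-congˡ e≈0) (zeroʳ t))

  annihilator-zero-or-invertible : Reduced R → Indecomposable R →
    ∀ {t z} → PowerTimesOnePlus t z → t * z ≈ 0# → (t ≈ 0#) ⊎ Invertible t
  annihilator-zero-or-invertible reduced indecomposable {t} (K , r , z≈) t*z≈0 =
    indecomposable-zero-or-invertible indecomposable t r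
      (reduced-drop-power reduced t K (1# + t * r) (trans (*-congˡ (sym z≈)) t*z≈0))

  ZeroOrInvertible : Set (c ⊔ ℓ)
  ZeroOrInvertible = ∀ x → (x ≈ 0#) ⊎ Invertible x

  NoZeroDivisors : Set (c ⊔ ℓ)
  NoZeroDivisors = ∀ x y → x * y ≈ 0# → (x ≈ 0#) ⊎ (y ≈ 0#)

  invertible-nonzero : Nontrivial R → ∀ {u} → Invertible u → ¬ u ≈ 0#
  invertible-nonzero nontrivial (v , uv≈1) u≈0 =
    nontrivial (trans (sym uv≈1) (trans (*-congʳ u≈0) (zeroˡ v)))

  field-no-zero-divisors : ZeroOrInvertible → NoZeroDivisors
  field-no-zero-divisors zero-or-invertible x y xy≈0 =
    Sum.map₂ (λ x-inv → invertible-cancelˡ x-inv (trans xy≈0 (sym (zeroʳ x)))) (zero-or-invertible x)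

  -- equality in a field is decidable: x - y is zero or invertible
  field-≟ : Nontrivial R → ZeroOrInvertible → Decidable _≈_
  field-≟ nontrivial zero-or-invertible x y with zero-or-invertible (x - y)
  ... | inj₁ x-y≈0   = yes (x∙y⁻¹≈ε⇒x≈y x y x-y≈0)
  ... | inj₂ x-y-inv = no (λ x≈y → invertible-nonzero nontrivial x-y-inv (x≈y⇒x∙y⁻¹≈ε x≈y))

  vandermonde-collision : Nontrivial R → NoZeroDivisors →
    ∀ t m n → vandermonde t m n ≈ 0# → Σ ℕ λ k → k ℕ.< m × t ^ k ≈ t ^ n
  vandermonde-collision nontrivial nzd t zero    n 1≈0 = ⊥-elim (nontrivial 1≈0)
  vandermonde-collision nontrivial nzd t (suc m) n ≈0 with nzd (vandermonde t m n) (t ^ m - t ^ n) ≈0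
  ... | inj₁ V≈0    = Prod.map₂ (Prod.map₁ ℕₚ.m≤n⇒m≤1+n) (vandermonde-collision nontrivial nzd t m n V≈0)
  ... | inj₂ diff≈0 = m , ℕₚ.≤-refl , x∙y⁻¹≈ε⇒x≈y _ _ diff≈0

  -- An invertible t with t^k = t^n for some k < n satisfies t^(n!) = 1:
  -- cancelling t^k gives t^d = 1 with 1 ≤ d ≤ n, and d divides n!.
  root-of-unity : ∀ {t k n} → Invertible t → k ℕ.< n → t ^ k ≈ t ^ n → t ^ (n ℕ.!) ≈ 1#
  root-of-unity {t} {k} {n} t-inv k<n t^k≈t^n with ℕₚ.m≤n⇒∃[o]m+o≡n k<n
  ... | d , ≡.refl with ∣-trans (m∣m*n (d ℕ.!)) (m≤n⇒m!∣n! (ℕ.s≤s (ℕₚ.m≤n+m d k)))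
  ... | divides q n!≡q*[1+d] = begin
    t ^ (n ℕ.!)           ≡⟨ ≡.cong (t ^_) (≡.trans n!≡q*[1+d] (ℕₚ.*-comm q (suc d))) ⟩
    t ^ (suc d ℕ.* q)     ≈⟨ ^-assocʳ t (suc d) q ⟨
    (t ^ suc d) ^ q       ≈⟨ ^-congˡ q t^[1+d]≈1 ⟩
    1# ^ q                ≈⟨ 1^n≈1 q ⟩
    1#                    ∎
    where
    t^[1+d]≈1 : t ^ suc d ≈ 1#
    t^[1+d]≈1 = invertible-cancelˡ (invertible-^ k t-inv) (begin
      t ^ k * t ^ suc d   ≈⟨ ^-homo-* t k (suc d) ⟨
      t ^ (k ℕ.+ suc d)   ≡⟨ ≡.cong (t ^_) (ℕₚ.+-suc k d) ⟩
      t ^ n               ≈⟨ t^k≈t^n ⟨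
      t ^ k               ≈⟨ *-identityʳ _ ⟨
      t ^ k * 1#          ∎)

  vandermonde-root-of-unity : Nontrivial R → NoZeroDivisors → ∀ {t} n →
    vandermonde t n n ≈ 0# → Invertible t → t ^ (n ℕ.!) ≈ 1#
  vandermonde-root-of-unity nontrivial nzd {t} n V≈0 t-inv
    with k , k<n , t^k≈t^n ← vandermonde-collision nontrivial nzd t n n V≈0 = root-of-unity t-inv k<n t^k≈t^n

  data Monic : ℕ → Poly R → Set (c ⊔ ℓ) where
    monic-constant : ∀ {a} → a ≈ 1# → Monic 0 (a ∷ [])
    monic-cons     : ∀ {D a p} → Monic D p → Monic (suc D) (a ∷ p)

  quotient : Poly R → Carrier → Poly R
  quotient []          c = []
  quotient (a ∷ [])    c = []
  quotient (a ∷ b ∷ p) c = eval R (b ∷ p) c ∷ quotient (b ∷ p) c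

  factor-theorem : ∀ p c x → eval R p x - eval R p c ≈ (x - c) * eval R (quotient p c) x
  factor-theorem []          c x = solve 2 (λ x c → con (+ 0) :- con (+ 0) := (x :- c) :* con (+ 0)) refl x c
  factor-theorem (a ∷ [])    c x =
    solve 3 (λ a x c → (a :+ x :* con (+ 0)) :- (a :+ c :* con (+ 0)) := (x :- c) :* con (+ 0)) refl a x c
  factor-theorem (a ∷ b ∷ p) c x = begin
    (a + x * Px) - (a + c * Pc)           ≈⟨ solve 5 (λ a x c Px Pc → (a :+ x :* Px) :- (a :+ c :* Pc)
                                                        := x :* (Px :- Pc) :+ (x :- c) :* Pc) refl a x c Px Pc ⟩
    x * (Px - Pc) + (x - c) * Pc          ≈⟨ +-congʳ (*-congˡ (factor-theorem (b ∷ p) c x)) ⟩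
    x * ((x - c) * Qx) + (x - c) * Pc     ≈⟨ solve 4 (λ x c Qx Pc → x :* ((x :- c) :* Qx) :+ (x :- c) :* Pc
                                                        := (x :- c) :* (Pc :+ x :* Qx)) refl x c Qx Pc ⟩
    (x - c) * (Pc + x * Qx)               ∎
    where
    Px = eval R (b ∷ p) x
    Pc = eval R (b ∷ p) c
    Qx = eval R (quotient (b ∷ p) c) x

  monic-quotient : ∀ {D p} c → Monic (suc D) p → Monic D (quotient p c)
  monic-quotient c (monic-cons (monic-constant {b} b≈1)) =
    monic-constant (trans (trans (+-congˡ (zeroʳ c)) (+-identityʳ b)) b≈1)
  monic-quotient c (monic-cons (monic-cons p-monic)) = monic-cons (monic-quotient c (monic-cons p-monic))

  Distinct : List Carrier → Set (c ⊔ ℓ)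
  Distinct = AllPairs (λ x y → ¬ x ≈ y)

  monic-root-bound : Nontrivial R → NoZeroDivisors → ∀ {D p} → Monic D p →
    ∀ cs → length cs ≡ suc D → Distinct cs → ¬ All (λ x → eval R p x ≈ 0#) cs
  monic-root-bound nontrivial nzd (monic-constant {a} a≈1) (x ∷ _) _ _ (px≈0 ∷ _) =
    nontrivial (trans (sym a≈1) (trans (sym (trans (+-congˡ (zeroʳ x)) (+-identityʳ a))) px≈0))
  monic-root-bound nontrivial nzd {suc D} {p} p-monic (x ∷ cs) len (x∉cs ∷ distinct) (px≈0 ∷ pcs≈0) =
    monic-root-bound nontrivial nzd (monic-quotient x p-monic) cs (ℕₚ.suc-injective len) distinct
      (All.zipWith quotient-root (x∉cs , pcs≈0))
    where
    quotient-root : ∀ {y} → ¬ x ≈ y × eval R p y ≈ 0# → eval R (quotient p x) y ≈ 0#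
    quotient-root {y} (x≉y , py≈0) with nzd (y - x) _ (begin
      (y - x) * eval R (quotient p x) y    ≈⟨ factor-theorem p x y ⟨
      eval R p y - eval R p x              ≈⟨ +-cong py≈0 (-‿cong px≈0) ⟩
      0# - 0#                              ≈⟨ -‿inverseʳ 0# ⟩
      0#                                   ∎)
    ... | inj₁ y-x≈0 = ⊥-elim (x≉y (sym (x∙y⁻¹≈ε⇒x≈y y x y-x≈0)))
    ... | inj₂ q≈0   = q≈0

  -- An infinite ring with decidable equality contains m distinct
  -- elements for every m (in the doubly negated sense: a list of m
  -- distinct elements that cannot be extended would enumerate R).
  distinct-elements : Infinite R → Decidable _≈_ →
    ∀ m → ¬ ¬ (Σ (List Carrier) λ cs → length cs ≡ m × Distinct cs)
  distinct-elements infinite _≟_ zero    k = k ([] , ≡.refl , [])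
  distinct-elements infinite _≟_ (suc m) k = distinct-elements infinite _≟_ m
    λ { (cs , len , distinct) → infinite (length cs , lookup cs , cover cs len distinct) }
    where
    cover : ∀ cs → length cs ≡ m → Distinct cs → ∀ x → ∃ λ i → x ≈ lookup cs i
    cover cs len distinct x with any? (x ≟_) cs
    ... | yes x∈cs = Any.index x∈cs , lookup-index x∈cs
    ... | no  x∉cs = ⊥-elim (k (x ∷ cs , ≡.cong suc len , ¬Any⇒All¬ cs x∉cs ∷ distinct))

  infinite-field-no-monic-identity : Nontrivial R → Infinite R → ZeroOrInvertible →
    ∀ {D p} → Monic D p → ¬ (∀ x → eval R p x ≈ 0#)
  infinite-field-no-monic-identity nontrivial infinite zero-or-invertible {D} p-monic p-vanishes =
    distinct-elements infinite (field-≟ nontrivial zero-or-invertible) (suc D) λ where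
      (cs , len , distinct) → monic-root-bound nontrivial (field-no-zero-divisors zero-or-invertible)
                                p-monic cs len distinct (All.universal p-vanishes cs)

  monomial : ℕ → Poly R
  monomial zero    = 1# ∷ []
  monomial (suc N) = 0# ∷ monomial N

  eval-monomial : ∀ N x → eval R (monomial N) x ≈ x ^ N
  eval-monomial zero    x = trans (+-congˡ (zeroʳ x)) (+-identityʳ 1#)
  eval-monomial (suc N) x = trans (+-identityˡ _) (*-congˡ (eval-monomial N x))

  monic-monomial : ∀ N → Monic N (monomial N)
  monic-monomial zero    = monic-constant refl
  monic-monomial (suc N) = monic-cons (monic-monomial N)

  x^[2+N]-x : ℕ → Poly R
  x^[2+N]-x N = 0# ∷ - 1# ∷ monomial N

  eval-x^[2+N]-x : ∀ N x → eval R (x^[2+N]-x N) x ≈ x * (x ^ suc N - 1#)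
  eval-x^[2+N]-x N x = begin
    0# + x * (- 1# + x * eval R (monomial N) x)   ≈⟨ +-congˡ (*-congˡ (+-congˡ (*-congˡ (eval-monomial N x)))) ⟩
    0# + x * (- 1# + x * x ^ N)                   ≈⟨ solve 2 (λ x a → con (+ 0) :+ x :* (:- con (+ 1) :+ x :* a)
                                                                := x :* (x :* a :- con (+ 1))) refl x (x ^ N) ⟩
    x * (x * x ^ N - 1#)                          ∎

  x^[2+N]-x-root : ∀ N t → (t ≈ 0#) ⊎ (t ^ suc N ≈ 1#) → eval R (x^[2+N]-x N) t ≈ 0#
  x^[2+N]-x-root N t (inj₁ t≈0)     = trans (eval-x^[2+N]-x N t) (trans (*-congʳ t≈0) (zeroˡ _))
  x^[2+N]-x-root N t (inj₂ t^[1+N]≈1) =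
    trans (eval-x^[2+N]-x N t) (trans (*-congˡ (trans (+-congʳ t^[1+N]≈1) (-‿inverseʳ 1#))) (zeroʳ t))

  -- If an infinite, reduced, indecomposable R had ∏_{k<n} (t^k - t^n) = 0
  -- for all t, every t would be zero or invertible (R a field) and every
  -- invertible t would satisfy t^k = t^n for some k < n, so t^(n!) = 1.
  -- Then x^(n!+1) - x vanishes on the infinite field R: impossible.
  vandermonde-not-identically-zero : Nontrivial R → Infinite R → Reduced R → Indecomposable R →
    ∀ n → ¬ (∀ t → vandermonde t n n ≈ 0#)
  vandermonde-not-identically-zero nontrivial infinite reduced indecomposable n V-vanishes =
    infinite-field-no-monic-identity nontrivial infinite zero-or-invertible
      (monic-cons (monic-cons (monic-monomial N))) x^[2+N]-x-vanishes
    where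
    zero-or-invertible : ZeroOrInvertible
    zero-or-invertible t = annihilator-zero-or-invertible reduced indecomposable
      (vandermonde-shape t n ℕₚ.≤-refl) (trans (*-congˡ (V-vanishes t)) (zeroʳ t))
    N : ℕ
    N = ℕ.pred (n ℕ.!)
    t^[1+N]≈1 : ∀ {t} → Invertible t → t ^ suc N ≈ 1#
    t^[1+N]≈1 {t} t-inv = trans (^-congʳ t (ℕₚ.suc-pred (n ℕ.!) {{n ℕₚ.!≢0}}))
      (vandermonde-root-of-unity nontrivial (field-no-zero-divisors zero-or-invertible) n (V-vanishes t) t-inv)
    x^[2+N]-x-vanishes : ∀ t → eval R (x^[2+N]-x N) t ≈ 0#
    x^[2+N]-x-vanishes t = x^[2+N]-x-root N t (Sum.map₂ t^[1+N]≈1 (zero-or-invertible t))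

  -- The leading coefficient b of an identically vanishing polynomial is 0:
  -- it is zero or invertible by the Vandermonde annihilation at t = b, and
  -- an invertible b would make every Vandermonde product vanish.
  leading-coefficient-vanishes : Nontrivial R → Infinite R → Reduced R → Indecomposable R →
    ∀ p b → (∀ x → eval R (p ++ b ∷ []) x ≈ 0#) → b ≈ 0#
  leading-coefficient-vanishes nontrivial infinite reduced indecomposable p b f-vanishes =
    Sum.[ id , (λ b-inv → ⊥-elim (vandermonde-not-identically-zero nontrivial infinite reduced indecomposable n
                                     (λ t → invertible-cancelˡ b-inv (trans (b·V≈0 t) (sym (zeroʳ b)))))) ]
      (annihilator-zero-or-invertible reduced indecomposable (vandermonde-shape b n ℕₚ.≤-refl) (b·V≈0 b))
    where
    n : ℕ
    n = length p
    b·V≈0 : ∀ t → b * vandermonde t n n ≈ 0#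
    b·V≈0 = leading-annihilates-vandermonde p b f-vanishes
  eval-snoc-zero : ∀ p {b} → b ≈ 0# → ∀ x → eval R (p ++ b ∷ []) x ≈ eval R p x
  eval-snoc-zero []      b≈0 x = trans (+-cong b≈0 (zeroʳ x)) (+-identityʳ 0#)
  eval-snoc-zero (a ∷ p) b≈0 x = +-congˡ (*-congˡ (eval-snoc-zero p b≈0 x))

  coefficients-vanish : Nontrivial R → Infinite R → Reduced R → Indecomposable R →
    ∀ {f} → Reverse f → (∀ x → eval R f x ≈ 0#) → IsZeroPoly R f
  coefficients-vanish _  _   _   _   []              _   = []
  coefficients-vanish nt inf red ind (p ∶ p-view ∶ʳ b) f-vanishes =
    ∷ʳ⁺ (coefficients-vanish nt inf red ind p-view (λ x → trans (sym (eval-snoc-zero p b≈0 x)) (f-vanishes x))) b≈0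
    where
    b≈0 : b ≈ 0#
    b≈0 = leading-coefficient-vanishes nt inf red ind p b f-vanishes

theorem3p12 : ∀ {c ℓ} (R : CommutativeRing c ℓ) →
    Nontrivial R → Infinite R → Reduced R → Indecomposable R →
    (f : Poly R) →
    (∀ (t : CommutativeRing.Carrier R) → CommutativeRing._≈_ R (eval R f t) (CommutativeRing.0# R)) →
    IsZeroPoly R f
theorem3p12 R nontrivial infinite reduced indecomposable f f-vanishes =
  coefficients-vanish R nontrivial infinite reduced indecomposable (reverseView f) f-vanishes
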